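{- Let $G=\mathbb{Z}\oplus\mathbb{Z}/\mu_1\mathbb{Z}\oplus\dots\oplus\mathbb{Z}/\mu_r\mathbb{Z}$ be in invariant factor form with $r\ge1$, and let $Q=[\omega_0,\dots,\omega_n]$, $\omega_i=(w_i,\eta_i)$, be a degree matrix in $G$ (so $Q$ is the degree matrix of a fwps $Z=Z(Q)$ with $\mathrm{Cl}(Z)\cong G$). Let $\mu\in\mathbb{Z}_{\ge2}$ and let $\zeta=[\zeta_0,\dots,\zeta_n]$ be a torsion vector of order $\mu$ for $w=[w_0,\dots,w_n]$. Let $Q_\zeta$ be the matrix with columns $(\omega_i,\zeta_i)$, $i=0,\dots,n$, and for $i=0,\dots,n$ let $Q_{\zeta,i}$ be $Q_\zeta$ with its $i$-th column removed. Then $Q_\zeta$ is a degree matrix in $G\oplus\mathbb{Z}/\mu\mathbb{Z}$ with this group in invariant factor form (i.e. $Q_\zeta$ is the degree matrix of a fwps with class group $G\oplus\mathbb{Z}/\mu\mathbb{Z}$) if and only if $\mu\mid\mu_r$ and, for each $i=0,\dots,n$, the maximal minors of $Q_{\zeta,i}$, with all entries reduced modulo $\mu$, generate $\mathbb{Z}/\mu\mathbb{Z}$.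
   Context: Invariant factor form: $\mathbb{Z}\oplus\mathbb{Z}/\mu_1\mathbb{Z}\oplus\dots\oplus\mathbb{Z}/\mu_s\mathbb{Z}$ with integers $\mu_i\ge2$ and $\mu_s\mid\mu_{s-1}\mid\dots\mid\mu_1$. A degree matrix in such a group $H$ is a matrix $[\omega_0,\dots,\omega_n]$ with columns $\omega_i=(w_i,\ldots)\in H$, $w_i\in\mathbb{Z}_{\ge1}$, such that any $n$ of the columns generate $H$; each such matrix is the degree matrix of a fake weighted projective space (fwps) of dimension $n$ whose class group is $H$, with the columns being the classes of the torus-invariant prime divisors. For a vector $w\in\mathbb{Z}_{\ge1}^{n+1}$ which is a degree matrix in $\mathbb{Z}$ (a weight vector) and $\mu\ge2$, a torsion vector of order $\mu$ for $w$ is a vector $\zeta\in(\mathbb{Z}/\mu\mathbb{Z})^{n+1}$ such that the $2\times(n+1)$ matrix with rows $w$ and $\zeta$ is a degree matrix in $\mathbb{Z}\oplus\mathbb{Z}/\mu\mathbb{Z}$. -}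

module Defs where

open import Data.Nat as ℕ using (ℕ; zero; suc)
open import Data.Nat.Divisibility as ℕD using ()
open import Data.Integer using (ℤ; +_; _+_; _-_; _*_; -_; 0ℤ; 1ℤ; _≤_)
open import Data.Integer.Divisibility using (_∣_)
open import Data.Fin as Fin using (Fin; zero; suc; toℕ; punchIn; fromℕ; _<_)
open import Data.Product using (Σ; ∃; _×_; proj₁)
open import Data.List using (List; []; _∷_)
open import Relation.Binary.PropositionalEquality using (_≡_)

-- Congruence modulo m in ℤ.  Modulus 0 means equality (the ℤ summand).

_≡[_]_ : ℤ → ℕ → ℤ → Set
a ≡[ m ] b = (+ m) ∣ (a - b)

∑ : {k : ℕ} → (Fin k → ℤ) → ℤ
∑ {zero}  f = 0ℤ
∑ {suc k} f = f zero + ∑ (λ j → f (suc j))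

-- Groups H = ℤ ⊕ ℤ/μ₁ ⊕ … ⊕ ℤ/μ_s, given by the torsion moduli
-- μs : Fin s → ℕ.  An element of H is represented by an integer
-- vector Fin (suc s) → ℤ (coordinate 0 = ℤ-part, coordinate suc j is a
-- representative of a class in ℤ/μs j); equality is coordinatewise
-- congruence modulo `modulus μs`.

modulus : {s : ℕ} → (Fin s → ℕ) → Fin (suc s) → ℕ
modulus μs zero    = 0
modulus μs (suc j) = μs j

InvariantFactorForm : {s : ℕ} → (Fin s → ℕ) → Set
InvariantFactorForm {s} μs =
  (∀ j → 2 ℕ.≤ μs j) ×
  (∀ (j k : Fin s) → toℕ k ≡ suc (toℕ j) → μs k ℕD.∣ μs j)

Mat : ℕ → ℕ → Set
Mat rows cols = Fin rows → Fin cols → ℤ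

GenerateWithout : {s n : ℕ} → (Fin s → ℕ) → Mat (suc s) (suc n) → Fin (suc n) → Set
GenerateWithout {s} {n} μs Q i =
  ∀ (h : Fin (suc s) → ℤ) →
    ∃ λ (c : Fin n → ℤ) →
      ∀ (ρ : Fin (suc s)) →
        ∑ (λ l → c l * Q ρ (punchIn i l)) ≡[ modulus μs ρ ] h ρ

IsDegreeMatrix : {s n : ℕ} → (Fin s → ℕ) → Mat (suc s) (suc n) → Set
IsDegreeMatrix μs Q =
  (∀ l → + 1 ≤ Q zero l) × (∀ i → GenerateWithout μs Q i)

snocℕ : {m : ℕ} → (Fin m → ℕ) → ℕ → Fin (suc m) → ℕ
snocℕ {zero}  f x zero    = x
snocℕ {suc m} f x zero    = f zero
snocℕ {suc m} f x (suc j) = snocℕ (λ k → f (suc k)) x j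

appendRow : {k m : ℕ} → Mat k m → (Fin m → ℤ) → Mat (suc k) m
appendRow {zero}  A v zero    = v
appendRow {suc k} A v zero    = A zero
appendRow {suc k} A v (suc ρ) = appendRow (λ ρ' → A (suc ρ')) v ρ

IsTorsionVector : {n : ℕ} → ℕ → (w ζ : Fin (suc n) → ℤ) → Set
IsTorsionVector μ w ζ = IsDegreeMatrix {1} (λ _ → μ) (appendRow (λ _ → w) ζ)

removeCol : {k n : ℕ} → Mat k (suc n) → Fin (suc n) → Mat k n
removeCol A i ρ l = A ρ (punchIn i l)

sign : {k : ℕ} → Fin k → ℤ
sign zero          = 1ℤ
sign (suc zero)    = - 1ℤ
sign (suc (suc j)) = sign j

det : {k : ℕ} → Mat k k → ℤ
det {zero}  A = 1ℤ
det {suc k} A = ∑ (λ j → sign j * (A zero j * det (λ a b → A (suc a) (punchIn j b))))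

StrictlyIncreasing : {k m : ℕ} → (Fin k → Fin m) → Set
StrictlyIncreasing σ = ∀ a b → a < b → σ a < σ b

ColumnChoice : ℕ → ℕ → Set
ColumnChoice k m = Σ (Fin k → Fin m) StrictlyIncreasing

minor : {k m : ℕ} → Mat k m → ColumnChoice k m → ℤ
minor A σ = det (λ a b → A a (proj₁ σ b))

sumMinors : {k m : ℕ} → Mat k m → List (ColumnChoice k m × ℤ) → ℤ
sumMinors A []             = 0ℤ
sumMinors A ((σ Data.Product., c) ∷ L) = c * minor A σ + sumMinors A L

MaximalMinorsGenerateMod : {k m : ℕ} → ℕ → Mat k m → Set
MaximalMinorsGenerateMod {k} {m} μ A =
  ∀ (h : ℤ) → ∃ λ (L : List (ColumnChoice k m × ℤ)) → sumMinors A L ≡[ μ ] h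

{-# OPTIONS --safe #-}
-- The columns of an integer k × m matrix A generate (ℤ/μ)^k exactly when its maximal
-- minors generate ℤ/μ, by induction on k.  If A x ≡ e₀ modulo μ, expanding
-- ∑ₗ x_l det [A_l | A_τ] along its first column shows that every maximal minor of the lower
-- k − 1 rows lies, modulo μ, in the ideal of maximal minors of A (each det [A_l | A_τ] is 0
-- or ± such a minor).  Conversely, expanding along the first row puts the minors of A into
-- the ideal of the lower rows, and A sends the cofactor vector of a minor to
-- (minor, 0, …, 0), which takes care of the first row.
-- For Q_ζ without its i-th column: invariant factor form of G ⊕ ℤ/μ amounts to μ ∣ μ_r and
-- makes μ divide every modulus, so generation gives surjectivity modulo μ; conversely a
-- solution modulo μ is corrected into one in G ⊕ ℤ/μ using that Q generates G.

module Submission where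

open import Defs
open import Data.Nat using (ℕ; suc; _≤_)
open import Data.Nat.Divisibility using (_∣_)
open import Data.Fin using (Fin; zero; fromℕ)
open import Data.Integer using (ℤ)
open import Data.Product using (_×_)
open import Function.Bundles using (_⇔_)

open import Data.Nat using (zero; z<s; s<s)
import Data.Nat.Properties as ℕ
open import Data.Nat.Divisibility using (∣-refl; ∣-trans; _∣0)
open import Data.Integer using (+_; _+_; _-_; _*_; -_; 0ℤ; 1ℤ)
import Data.Integer.Properties as ℤ
open import Data.Integer.Divisibility.Signed as Signed using (divides) renaming (_∣_ to _∣ℤ_)
open import Data.Integer.Tactic.RingSolver using (solve-∀)
open import Data.Fin using (suc; punchIn; toℕ; inject₁; _<_)
import Data.Fin.Properties as Fin
open import Data.Vec.Functional using (_∷_; tail; init; last)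
open import Data.List as List using (List; []; _++_)
open import Data.Product using (∃; _,_; proj₁; proj₂; map₂)
open import Data.Sum using (_⊎_; inj₁; inj₂)
import Algebra.Properties.Semiring.Sum ℤ.+-*-semiring as Sum
open Sum using (sum)
open import Function using (_∘_)
open import Function.Bundles using (mk⇔; Equivalence)
open import Relation.Binary.Bundles using (Setoid)
open import Relation.Binary.Structures using (IsEquivalence)
open import Relation.Binary.Definitions using (tri<; tri≈; tri>)
open import Relation.Binary.PropositionalEquality

private
  variable
    k m n r s μ : ℕ
    a b a′ b′ y z : ℤ

-- Congruence modulo μ

infix 4 _≈[_]_

-- A copy of _≡[_]_ as a record, so that its indices can be inferred.
record _≈[_]_ (a : ℤ) (μ : ℕ) (b : ℤ) : Set where
  constructor mk≈
  field μ∣a-b : + μ ∣ℤ a - b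

≡[]⇒≈ : a ≡[ μ ] b → a ≈[ μ ] b
≡[]⇒≈ p = mk≈ (Signed.∣ᵤ⇒∣ p)

≈⇒≡[] : a ≈[ μ ] b → a ≡[ μ ] b
≈⇒≡[] (mk≈ p) = Signed.∣⇒∣ᵤ p

≈-reflexive : a ≡ b → a ≈[ μ ] b
≈-reflexive {a} {μ = μ} refl = mk≈ (divides 0ℤ (trans (ℤ.+-inverseʳ a) (sym (ℤ.*-zeroˡ (+ μ)))))

≈-sym : a ≈[ μ ] b → b ≈[ μ ] a
≈-sym {a} {b = b} (mk≈ p) = mk≈ (subst (_ ∣ℤ_) (neg-minus a b) (Signed.∣m⇒∣-m p))
  where
  neg-minus : ∀ a b → - (a - b) ≡ b - a
  neg-minus = solve-∀

≈-trans : a ≈[ μ ] b → b ≈[ μ ] a′ → a ≈[ μ ] a′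
≈-trans {a} {b = b} {a′ = a′} (mk≈ p) (mk≈ q) =
  mk≈ (subst (_ ∣ℤ_) (ℤ.+-minus-telescope a b a′) (Signed.∣m∣n⇒∣m+n p q))

≈-refl : a ≈[ μ ] a
≈-refl = ≈-reflexive refl

≈-isEquivalence : IsEquivalence (_≈[ μ ]_)
≈-isEquivalence = record { refl = ≈-refl ; sym = ≈-sym ; trans = ≈-trans }

≈-setoid : ℕ → Setoid _ _
≈-setoid μ = record { isEquivalence = ≈-isEquivalence {μ} }

module ≈-Reasoning (μ : ℕ) where
  open import Relation.Binary.Reasoning.Setoid (≈-setoid μ) public

+-cong-≈ : a ≈[ μ ] b → a′ ≈[ μ ] b′ → a + a′ ≈[ μ ] b + b′
+-cong-≈ {a} {b = b} {a′} {b′ = b′} (mk≈ p) (mk≈ q) =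
  mk≈ (subst (_ ∣ℤ_) (interchange a b a′ b′) (Signed.∣m∣n⇒∣m+n p q))
  where
  interchange : ∀ a b c d → (a - b) + (c - d) ≡ (a + c) - (b + d)
  interchange = solve-∀

+-congˡ-≈ : ∀ c → a ≈[ μ ] b → c + a ≈[ μ ] c + b
+-congˡ-≈ c = +-cong-≈ (≈-refl {c})

*-congˡ-≈ : ∀ c → a ≈[ μ ] b → c * a ≈[ μ ] c * b
*-congˡ-≈ {a} {b = b} c (mk≈ p) = mk≈ (subst (_ ∣ℤ_) (distrib c a b) (Signed.∣n⇒∣m*n c p))
  where
  distrib : ∀ c a b → c * (a - b) ≡ c * a - c * b
  distrib = solve-∀

*μ≈0 : ∀ a → a * + μ ≈[ μ ] 0ℤ
*μ≈0 {μ} a = mk≈ (divides a (ℤ.+-identityʳ (a * + μ)))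

≈-weaken : ∀ {ν} → ν ∣ μ → a ≈[ μ ] b → a ≈[ ν ] b
≈-weaken ν∣μ (mk≈ p) = mk≈ (Signed.∣-trans (Signed.∣ᵤ⇒∣ ν∣μ) p)

-- Finite sums and column spans

∑≡sum : (f : Fin k → ℤ) → ∑ f ≡ sum f
∑≡sum {zero}  f = refl
∑≡sum {suc k} f = cong (_+_ (f zero)) (∑≡sum (f ∘ suc))

∑-cong : {f g : Fin k → ℤ} → f ≗ g → ∑ f ≡ ∑ g
∑-cong {f = f} {g} f≗g = trans (∑≡sum f) (trans (Sum.sum-cong-≗ f≗g) (sym (∑≡sum g)))

∑-distrib-+ : (f g : Fin k → ℤ) → ∑ (λ j → f j + g j) ≡ ∑ f + ∑ g
∑-distrib-+ f g =
  trans (∑≡sum (λ j → f j + g j)) (trans (Sum.∑-distrib-+ f g) (sym (cong₂ _+_ (∑≡sum f) (∑≡sum g))))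

*-distribˡ-∑ : ∀ c (f : Fin k → ℤ) → c * ∑ f ≡ ∑ (λ j → c * f j)
*-distribˡ-∑ c f =
  trans (cong (c *_) (∑≡sum f)) (trans (Sum.*-distribˡ-sum c f) (sym (∑≡sum (λ j → c * f j))))

∑-comm : (F : Fin k → Fin m → ℤ) → ∑ (λ i → ∑ (F i)) ≡ ∑ (λ j → ∑ (λ i → F i j))
∑-comm F = begin
  ∑ (λ i → ∑ (F i))                ≡⟨ ∑∑≡sum-sum F ⟩
  sum (λ i → sum (F i))            ≡⟨ Sum.∑-comm F ⟩
  sum (λ j → sum (λ i → F i j))    ≡⟨ ∑∑≡sum-sum (λ j i → F i j) ⟨
  ∑ (λ j → ∑ (λ i → F i j))        ∎
  where
  open ≡-Reasoning
  ∑∑≡sum-sum : ∀ {k m} (G : Fin k → Fin m → ℤ) → ∑ (λ i → ∑ (G i)) ≡ sum (λ i → sum (G i))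
  ∑∑≡sum-sum G = trans (∑≡sum (λ i → ∑ (G i))) (Sum.sum-cong-≗ (∑≡sum ∘ G))

∑-zero : ∀ k → ∑ {k} (λ _ → 0ℤ) ≡ 0ℤ
∑-zero k = trans (∑≡sum {k} (λ _ → 0ℤ)) (Sum.sum-replicate-zero k)

∑-neg : (f : Fin k → ℤ) → ∑ (λ j → - f j) ≡ - ∑ f
∑-neg f = begin
  ∑ (λ j → - f j)          ≡⟨ ∑-cong (λ j → sym (ℤ.-1*i≡-i (f j))) ⟩
  ∑ (λ j → - 1ℤ * f j)     ≡⟨ *-distribˡ-∑ (- 1ℤ) f ⟨
  - 1ℤ * ∑ f               ≡⟨ ℤ.-1*i≡-i (∑ f) ⟩
  - ∑ f                    ∎
  where open ≡-Reasoning

∑-cong-≈ : {f g : Fin k → ℤ} → (∀ j → f j ≈[ μ ] g j) → ∑ f ≈[ μ ] ∑ g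
∑-cong-≈ {zero}  f≈g = ≈-reflexive refl
∑-cong-≈ {suc k} f≈g = +-cong-≈ (f≈g zero) (∑-cong-≈ (f≈g ∘ suc))

unit : Fin m → Fin m → ℤ
unit zero    zero    = 1ℤ
unit zero    (suc j) = 0ℤ
unit (suc l) zero    = 0ℤ
unit (suc l) (suc j) = unit l j

∑-unit : ∀ (l : Fin m) (f : Fin m → ℤ) → ∑ (λ j → unit l j * f j) ≡ f l
∑-unit {suc m} zero f = begin
  1ℤ * f zero + ∑ (λ j → 0ℤ * f (suc j))   ≡⟨ cong₂ _+_ (ℤ.*-identityˡ (f zero)) (∑-cong (ℤ.*-zeroˡ ∘ f ∘ suc)) ⟩
  f zero + ∑ {m} (λ _ → 0ℤ)                 ≡⟨ cong (_+_ (f zero)) (∑-zero m) ⟩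
  f zero + 0ℤ                               ≡⟨ ℤ.+-identityʳ (f zero) ⟩
  f zero                                    ∎
  where open ≡-Reasoning
∑-unit (suc l) f = trans (cong (λ s → s + ∑ (λ j → unit l j * f (suc j))) (ℤ.*-zeroˡ (f zero)))
                         (trans (ℤ.+-identityˡ _) (∑-unit l (f ∘ suc)))

infixl 7 _·_
_·_ : Mat k m → (Fin m → ℤ) → Fin k → ℤ
(A · x) ρ = ∑ (λ l → x l * A ρ l)

·-distrib-+ : (A : Mat k m) (x y : Fin m → ℤ) → A · (λ l → x l + y l) ≗ λ ρ → (A · x) ρ + (A · y) ρ
·-distrib-+ A x y ρ =
  trans (∑-cong (λ l → ℤ.*-distribʳ-+ (A ρ l) (x l) (y l))) (∑-distrib-+ (λ l → x l * A ρ l) (λ l → y l * A ρ l))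

·-scale : (A : Mat k m) (t : ℤ) (x : Fin m → ℤ) → A · (λ l → t * x l) ≗ λ ρ → t * (A · x) ρ
·-scale A t x ρ = trans (∑-cong (λ l → ℤ.*-assoc t (x l) (A ρ l))) (sym (*-distribˡ-∑ t (λ l → x l * A ρ l)))

ColumnSpan : Mat k m → (Fin k → ℤ) → Set
ColumnSpan A y = ∃ λ x → A · x ≗ y

module _ (A : Mat k m) where

  span-resp-≗ : ∀ {y z} → y ≗ z → ColumnSpan A y → ColumnSpan A z
  span-resp-≗ y≗z (x , Ax≗y) = x , λ ρ → trans (Ax≗y ρ) (y≗z ρ)

  span-column : ∀ l → ColumnSpan A (λ ρ → A ρ l)
  span-column l = unit l , λ ρ → ∑-unit l (A ρ)

  span-0 : ColumnSpan A (λ _ → 0ℤ)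
  span-0 = (λ _ → 0ℤ) , λ ρ → trans (∑-cong (λ l → ℤ.*-zeroˡ (A ρ l))) (∑-zero m)

  span-+ : ∀ {y z} → ColumnSpan A y → ColumnSpan A z → ColumnSpan A (λ ρ → y ρ + z ρ)
  span-+ (x , Ax≗y) (x′ , Ax′≗z) =
    (λ l → x l + x′ l) , λ ρ → trans (·-distrib-+ A x x′ ρ) (cong₂ _+_ (Ax≗y ρ) (Ax′≗z ρ))

  span-scale : ∀ t {y} → ColumnSpan A y → ColumnSpan A (λ ρ → t * y ρ)
  span-scale t (x , Ax≗y) = (λ l → t * x l) , λ ρ → trans (·-scale A t x ρ) (cong (t *_) (Ax≗y ρ))

  span-∑ : ∀ {j} (Y : Fin j → Fin k → ℤ) → (∀ i → ColumnSpan A (Y i)) →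
           ColumnSpan A (λ ρ → ∑ (λ i → Y i ρ))
  span-∑ {zero}  Y spans = span-0
  span-∑ {suc j} Y spans = span-+ (spans zero) (span-∑ (Y ∘ suc) (spans ∘ suc))

-- Determinants

columns : Mat k m → (Fin n → Fin m) → Mat k n
columns A g a b = A a (g b)

_ᵀ : Mat k k → Mat k k
(M ᵀ) a b = M b a

sign-suc : (j : Fin k) → sign (suc j) ≡ - sign j
sign-suc zero    = refl
sign-suc (suc j) = sym (trans (cong -_ (sign-suc j)) (ℤ.neg-involutive (sign j)))

x≡-x⇒x≡0 : ∀ x → x ≡ - x → x ≡ 0ℤ
x≡-x⇒x≡0 x x≡-x = ℤ.*-cancelˡ-≡ (+ 2) x 0ℤ (begin
  + 2 * x     ≡⟨ double x ⟩
  x + x       ≡⟨ cong (_+_ x) x≡-x ⟩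
  x + - x     ≡⟨ ℤ.+-inverseʳ x ⟩
  0ℤ          ≡⟨ ℤ.*-zeroʳ (+ 2) ⟨
  + 2 * 0ℤ    ∎)
  where
  open ≡-Reasoning
  double : ∀ x → + 2 * x ≡ x + x
  double = solve-∀

det-cong : {M N : Mat k k} → (∀ a b → M a b ≡ N a b) → det M ≡ det N
det-cong {zero}  M≡N = refl
det-cong {suc k} M≡N = ∑-cong λ j →
  cong₂ (λ x d → sign j * (x * d)) (M≡N zero j) (det-cong (λ a b → M≡N (suc a) (punchIn j b)))

*-*-distribˡ-∑ : ∀ x y (f : Fin k → ℤ) → x * (y * ∑ f) ≡ ∑ (λ j → x * (y * f j))
*-*-distribˡ-∑ x y f = trans (cong (x *_) (*-distribˡ-∑ y f)) (*-distribˡ-∑ x (λ j → y * f j))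

det-expand-first-column : (M : Mat (suc k) (suc k)) →
  det M ≡ ∑ (λ i → sign i * (M i zero * det (λ a b → M (punchIn i a) (suc b))))
det-expand-first-column {zero}  M = refl
det-expand-first-column {suc k} M = cong (_+_ (1ℤ * (M zero zero * D₀₀))) (begin
    ∑ (λ j → sign (suc j) * (M zero (suc j) * det (λ a b → M (suc a) (punchIn (suc j) b))))
  ≡⟨ ∑-cong (λ j → cong (λ d → sign (suc j) * (M zero (suc j) * d))
                        (det-expand-first-column (λ a b → M (suc a) (punchIn (suc j) b)))) ⟩
    ∑ (λ j → sign (suc j) * (M zero (suc j) * ∑ (λ i → sign i * (M (suc i) zero * D i j))))
  ≡⟨ ∑-cong (λ j → *-*-distribˡ-∑ (sign (suc j)) (M zero (suc j))
                                   (λ i → sign i * (M (suc i) zero * D i j))) ⟩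
    ∑ (λ j → ∑ (λ i → sign (suc j) * (M zero (suc j) * (sign i * (M (suc i) zero * D i j)))))
  ≡⟨ ∑-comm (λ j i → sign (suc j) * (M zero (suc j) * (sign i * (M (suc i) zero * D i j)))) ⟩
    ∑ (λ i → ∑ (λ j → sign (suc j) * (M zero (suc j) * (sign i * (M (suc i) zero * D i j)))))
  ≡⟨ ∑-cong (λ i → ∑-cong (λ j → exchange i j (M zero (suc j)) (M (suc i) zero) (D i j))) ⟩
    ∑ (λ i → ∑ (λ j → sign (suc i) * (M (suc i) zero * (sign j * (M zero (suc j) * D i j)))))
  ≡⟨ ∑-cong (λ i → *-*-distribˡ-∑ (sign (suc i)) (M (suc i) zero)
                                   (λ j → sign j * (M zero (suc j) * D i j))) ⟨
    ∑ (λ i → sign (suc i) * (M (suc i) zero * ∑ (λ j → sign j * (M zero (suc j) * D i j))))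
  ∎)
  where
  open ≡-Reasoning
  D₀₀ : ℤ
  D₀₀ = det (λ a b → M (suc a) (suc b))
  D : Fin (suc k) → Fin (suc k) → ℤ
  D i j = det (λ a b → M (suc (punchIn i a)) (suc (punchIn j b)))
  exchange : ∀ (i j : Fin (suc k)) x y d →
    sign (suc j) * (x * (sign i * (y * d))) ≡ sign (suc i) * (y * (sign j * (x * d)))
  exchange i j x y d rewrite sign-suc i | sign-suc j = ring (sign i) (sign j) x y d
    where
    ring : ∀ s t x y d → - t * (x * (s * (y * d))) ≡ - s * (y * (t * (x * d)))
    ring = solve-∀

det-transpose : (M : Mat k k) → det (M ᵀ) ≡ det M
det-transpose {zero}  M = refl
det-transpose {suc k} M = trans
  (∑-cong (λ j → cong (λ d → sign j * (M j zero * d)) (det-transpose (λ a b → M (punchIn j a) (suc b)))))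
  (sym (det-expand-first-column M))

swap₀₁ : Fin (suc (suc k)) → Fin (suc (suc k))
swap₀₁ zero          = suc zero
swap₀₁ (suc zero)    = zero
swap₀₁ (suc (suc b)) = suc (suc b)

swap₀₁-suc : (b : Fin (suc k)) → swap₀₁ (suc b) ≡ punchIn (suc zero) b
swap₀₁-suc zero    = refl
swap₀₁-suc (suc b) = refl

swap₀₁-punchIn₁ : (b : Fin (suc k)) → swap₀₁ (punchIn (suc zero) b) ≡ suc b
swap₀₁-punchIn₁ zero    = refl
swap₀₁-punchIn₁ (suc b) = refl

swap₀₁-punchIn : (j : Fin (suc k)) (b : Fin (suc (suc k))) →
  swap₀₁ (punchIn (suc (suc j)) b) ≡ punchIn (suc (suc j)) (swap₀₁ b)
swap₀₁-punchIn j zero          = refl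
swap₀₁-punchIn j (suc zero)    = refl
swap₀₁-punchIn j (suc (suc b)) = refl

firstRowTerm : Mat (suc k) (suc k) → Fin (suc k) → ℤ
firstRowTerm M j = sign j * (M zero j * det (λ a b → M (suc a) (punchIn j b)))

det-swap-columns : (M : Mat (suc (suc k)) (suc (suc k))) → det (columns M swap₀₁) ≡ - det M
det-swap-columns-rest : ∀ k (M : Mat (suc (suc k)) (suc (suc k))) →
  ∑ (λ j → firstRowTerm (columns M swap₀₁) (suc (suc j))) ≡ - ∑ (λ j → firstRowTerm M (suc (suc j)))

det-swap-columns {k} M = begin
    det (columns M swap₀₁)
  ≡⟨ cong₂ (λ x y → 1ℤ * (M zero (suc zero) * x) + (- 1ℤ * (M zero zero * y) + R′))
           (det-cong (λ a b → cong (M (suc a)) (swap₀₁-suc b)))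
           (det-cong (λ a b → cong (M (suc a)) (swap₀₁-punchIn₁ b))) ⟩
    1ℤ * (M zero (suc zero) * X) + (- 1ℤ * (M zero zero * Y) + R′)
  ≡⟨ cong (λ R → 1ℤ * (M zero (suc zero) * X) + (- 1ℤ * (M zero zero * Y) + R)) (det-swap-columns-rest k M) ⟩
    1ℤ * (M zero (suc zero) * X) + (- 1ℤ * (M zero zero * Y) + - R)
  ≡⟨ swap-first-terms (M zero (suc zero)) X (M zero zero) Y R ⟩
    - det M
  ∎
  where
  open ≡-Reasoning
  X = det (λ a b → M (suc a) (punchIn (suc zero) b))
  Y = det (λ a b → M (suc a) (suc b))
  R = ∑ (λ j → firstRowTerm M (suc (suc j)))
  R′ = ∑ (λ j → firstRowTerm (columns M swap₀₁) (suc (suc j)))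
  swap-first-terms : ∀ x X y Y R →
    1ℤ * (x * X) + (- 1ℤ * (y * Y) + - R) ≡ - (1ℤ * (y * Y) + (- 1ℤ * (x * X) + R))
  swap-first-terms = solve-∀

det-swap-columns-rest zero    M = refl
det-swap-columns-rest (suc k) M = trans (∑-cong swapped) (∑-neg (λ j → firstRowTerm M (suc (suc j))))
  where
  negate-cofactor : ∀ s x d → s * (x * - d) ≡ - (s * (x * d))
  negate-cofactor = solve-∀
  swapped : ∀ j → firstRowTerm (columns M swap₀₁) (suc (suc j)) ≡ - firstRowTerm M (suc (suc j))
  swapped j = trans
    (cong (λ d → sign (suc (suc j)) * (M zero (suc (suc j)) * d))
          (trans (det-cong (λ a b → cong (M (suc a)) (swap₀₁-punchIn j b)))
                 (det-swap-columns (λ a b → M (suc a) (punchIn (suc (suc j)) b)))))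
    (negate-cofactor (sign (suc (suc j))) (M zero (suc (suc j)))
                     (det (λ a b → M (suc a) (punchIn (suc (suc j)) b))))

det-swap-rows : (M : Mat (suc (suc k)) (suc (suc k))) → det (λ a b → M (swap₀₁ a) b) ≡ - det M
det-swap-rows M = begin
  det (λ a b → M (swap₀₁ a) b)   ≡⟨ det-transpose (λ a b → M (swap₀₁ a) b) ⟨
  det (columns (M ᵀ) swap₀₁)     ≡⟨ det-swap-columns (M ᵀ) ⟩
  - det (M ᵀ)                    ≡⟨ cong -_ (det-transpose M) ⟩
  - det M                        ∎
  where open ≡-Reasoning

det-equal-rows : (M : Mat (suc k) (suc k)) (r : Fin k) → M zero ≗ M (suc r) → det M ≡ 0ℤ
det-equal-rows M zero M₀≗M₁ = x≡-x⇒x≡0 (det M) (trans (det-cong swap-invariant) (det-swap-rows M))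
  where
  swap-invariant : ∀ a b → M a b ≡ M (swap₀₁ a) b
  swap-invariant zero          b = M₀≗M₁ b
  swap-invariant (suc zero)    b = sym (M₀≗M₁ b)
  swap-invariant (suc (suc a)) b = refl
det-equal-rows {suc k} M (suc r) M₀≗Mᵣ = begin
    det M                         ≡⟨ ℤ.neg-involutive (det M) ⟨
    - - det M                     ≡⟨ cong -_ (det-swap-rows M) ⟨
    - det N                       ≡⟨ cong -_ (trans (∑-cong vanishing) (∑-zero (suc (suc k)))) ⟩
    - 0ℤ                          ≡⟨⟩
    0ℤ                            ∎
  where
  open ≡-Reasoning
  N : Mat (suc (suc k)) (suc (suc k))
  N a b = M (swap₀₁ a) b
  vanishing : ∀ j → firstRowTerm N j ≡ 0ℤ
  vanishing j = begin
    sign j * (N zero j * det (λ a b → N (suc a) (punchIn j b)))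
      ≡⟨ cong (λ d → sign j * (N zero j * d))
              (det-equal-rows (λ a b → N (suc a) (punchIn j b)) r (M₀≗Mᵣ ∘ punchIn j)) ⟩
    sign j * (N zero j * 0ℤ)      ≡⟨ cong (sign j *_) (ℤ.*-zeroʳ (N zero j)) ⟩
    sign j * 0ℤ                   ≡⟨ ℤ.*-zeroʳ (sign j) ⟩
    0ℤ                            ∎

det-equal-first-columns : (M : Mat (suc (suc k)) (suc (suc k))) → (∀ a → M a zero ≡ M a (suc zero)) →
                          det M ≡ 0ℤ
det-equal-first-columns M equal = x≡-x⇒x≡0 (det M) (trans (det-cong swap-invariant) (det-swap-columns M))
  where
  swap-invariant : ∀ a b → M a b ≡ M a (swap₀₁ b)
  swap-invariant a zero          = equal a
  swap-invariant a (suc zero)    = sym (equal a)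
  swap-invariant a (suc (suc b)) = refl

-- Maximal minors

det-prepend-scaled : {g g′ : Fin k → Fin m} (c : ℤ) →
  (∀ (B : Mat k m) → det (columns B g) ≡ c * det (columns B g′)) →
  ∀ (A : Mat (suc k) m) x → det (columns A (x ∷ g)) ≡ c * det (columns A (x ∷ g′))
det-prepend-scaled {g = g} {g′} c scaled A x = begin
    det (columns A (x ∷ g))
  ≡⟨ det-expand-first-column (columns A (x ∷ g)) ⟩
    ∑ (λ i → sign i * (A i x * det (columns (A ∘ punchIn i) g)))
  ≡⟨ ∑-cong (λ i → trans (cong (λ d → sign i * (A i x * d)) (scaled (A ∘ punchIn i)))
                         (pull (sign i) (A i x) c (det (columns (A ∘ punchIn i) g′)))) ⟩
    ∑ (λ i → c * (sign i * (A i x * det (columns (A ∘ punchIn i) g′))))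
  ≡⟨ *-distribˡ-∑ c (λ i → sign i * (A i x * det (columns (A ∘ punchIn i) g′))) ⟨
    c * ∑ (λ i → sign i * (A i x * det (columns (A ∘ punchIn i) g′)))
  ≡⟨ cong (c *_) (det-expand-first-column (columns A (x ∷ g′))) ⟨
    c * det (columns A (x ∷ g′))
  ∎
  where
  open ≡-Reasoning
  pull : ∀ s a c d → s * (a * (c * d)) ≡ c * (s * (a * d))
  pull = solve-∀

∷-increasing : ∀ {x} {g : Fin k → Fin m} → StrictlyIncreasing g → (∀ b → x < g b) →
               StrictlyIncreasing (x ∷ g)
∷-increasing g-inc x<g zero    (suc b) _         = x<g b
∷-increasing g-inc x<g (suc a) (suc b) (s<s a<b) = g-inc a b a<b

<-head⇒<-all : ∀ {x : Fin m} {τ : Fin (suc k) → Fin m} → StrictlyIncreasing τ →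
               x < τ zero → ∀ b → x < τ b
<-head⇒<-all τ-inc x<τ₀ zero    = x<τ₀
<-head⇒<-all τ-inc x<τ₀ (suc b) = ℕ.<-trans x<τ₀ (τ-inc zero (suc b) z<s)

-- The last field of signed-minor lets the recursive case of insert show that τ zero ∷ σ
-- is still increasing.
data Insertion (l : Fin m) (τ : Fin k → Fin m) : Set where
  degenerate   : (∀ A → det (columns A (l ∷ τ)) ≡ 0ℤ) → Insertion l τ
  signed-minor : (σ : ColumnChoice (suc k) m) (ε : ℤ) →
                 (∀ A → det (columns A (l ∷ τ)) ≡ ε * minor A σ) →
                 (∀ b → proj₁ σ b ≡ l ⊎ ∃ λ b′ → proj₁ σ b ≡ τ b′) →
                 Insertion l τ

insert : (l : Fin m) (τ : Fin k → Fin m) → StrictlyIncreasing τ → Insertion l τ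
insert {k = zero} l τ _ =
  signed-minor ((l ∷ τ) , ∷-increasing (λ ()) (λ ())) 1ℤ (λ A → sym (ℤ.*-identityˡ _)) values
  where
  values : ∀ b → (l ∷ τ) b ≡ l ⊎ ∃ λ b′ → (l ∷ τ) b ≡ τ b′
  values zero = inj₁ refl
insert {k = suc k} l τ τ-inc with Fin.<-cmp l (τ zero)
... | tri< l<τ₀ _ _ =
  signed-minor ((l ∷ τ) , ∷-increasing τ-inc (<-head⇒<-all τ-inc l<τ₀)) 1ℤ
               (λ A → sym (ℤ.*-identityˡ _)) values
  where
  values : ∀ b → (l ∷ τ) b ≡ l ⊎ ∃ λ b′ → (l ∷ τ) b ≡ τ b′
  values zero    = inj₁ refl
  values (suc b) = inj₂ (b , refl)
... | tri≈ _ l≡τ₀ _ =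
  degenerate (λ A → det-equal-first-columns (columns A (l ∷ τ)) (λ a → cong (A a) l≡τ₀))
... | tri> _ _ τ₀<l = after-swap (insert l (τ ∘ suc) (λ a b a<b → τ-inc (suc a) (suc b) (s<s a<b)))
  where
  swap-eq : ∀ A → det (columns A (l ∷ τ)) ≡ - det (columns A (τ zero ∷ l ∷ τ ∘ suc))
  swap-eq A = trans (det-cong swapped) (det-swap-columns (columns A (τ zero ∷ l ∷ τ ∘ suc)))
    where
    swapped : ∀ a b → columns A (l ∷ τ) a b ≡ columns A (τ zero ∷ l ∷ τ ∘ suc) a (swap₀₁ b)
    swapped a zero          = refl
    swapped a (suc zero)    = refl
    swapped a (suc (suc b)) = refl
  after-swap : Insertion l (τ ∘ suc) → Insertion l τ
  after-swap (degenerate vanishes) = degenerate λ A → begin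
    det (columns A (l ∷ τ))                          ≡⟨ swap-eq A ⟩
    - det (columns A (τ zero ∷ l ∷ τ ∘ suc))
      ≡⟨ cong -_ (det-prepend-scaled {g = l ∷ τ ∘ suc} {l ∷ τ ∘ suc} 0ℤ vanishes′ A (τ zero)) ⟩
    - (0ℤ * det (columns A (τ zero ∷ l ∷ τ ∘ suc)))
      ≡⟨ cong -_ (ℤ.*-zeroˡ (det (columns A (τ zero ∷ l ∷ τ ∘ suc)))) ⟩
    0ℤ                                               ∎
    where
    open ≡-Reasoning
    vanishes′ : ∀ B → det (columns B (l ∷ τ ∘ suc)) ≡ 0ℤ * det (columns B (l ∷ τ ∘ suc))
    vanishes′ B = trans (vanishes B) (sym (ℤ.*-zeroˡ (det (columns B (l ∷ τ ∘ suc)))))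
  after-swap (signed-minor (σ , σ-inc) ε eq values) =
    signed-minor ((τ zero ∷ σ) , ∷-increasing σ-inc τ₀<σ) (- ε) eq′ values′
    where
    τ₀<σ : ∀ b → τ zero < σ b
    τ₀<σ b with values b
    ... | inj₁ σb≡l        = subst (τ zero <_) (sym σb≡l) τ₀<l
    ... | inj₂ (b′ , σb≡τ) = subst (τ zero <_) (sym σb≡τ) (τ-inc zero (suc b′) z<s)
    eq′ : ∀ A → det (columns A (l ∷ τ)) ≡ - ε * minor A ((τ zero ∷ σ) , ∷-increasing σ-inc τ₀<σ)
    eq′ A = trans (swap-eq A) (trans (cong -_ (det-prepend-scaled ε eq A (τ zero))) (ℤ.neg-distribˡ-* ε _))
    values′ : ∀ b → (τ zero ∷ σ) b ≡ l ⊎ ∃ λ b′ → (τ zero ∷ σ) b ≡ τ b′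
    values′ zero = inj₂ (zero , refl)
    values′ (suc b) with values b
    ... | inj₁ σb≡l        = inj₁ σb≡l
    ... | inj₂ (b′ , σb≡τ) = inj₂ (suc b′ , σb≡τ)

InMinorIdeal : ℕ → Mat k m → ℤ → Set
InMinorIdeal μ A y = ∃ λ L → sumMinors A L ≈[ μ ] y

sumMinors-++ : (A : Mat k m) (L L′ : List (ColumnChoice k m × ℤ)) →
  sumMinors A (L ++ L′) ≡ sumMinors A L + sumMinors A L′
sumMinors-++ A []                 L′ = sym (ℤ.+-identityˡ (sumMinors A L′))
sumMinors-++ A ((σ , c) List.∷ L) L′ =
  trans (cong (_+_ (c * minor A σ)) (sumMinors-++ A L L′))
        (sym (ℤ.+-assoc (c * minor A σ) (sumMinors A L) (sumMinors A L′)))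

sumMinors-scale : (A : Mat k m) (t : ℤ) (L : List (ColumnChoice k m × ℤ)) →
  sumMinors A (List.map (map₂ (t *_)) L) ≡ t * sumMinors A L
sumMinors-scale A t []                 = sym (ℤ.*-zeroʳ t)
sumMinors-scale A t ((σ , c) List.∷ L) =
  trans (cong (_+_ (t * c * minor A σ)) (sumMinors-scale A t L)) (distrib t c (minor A σ) (sumMinors A L))
  where
  distrib : ∀ t c d s → t * c * d + t * s ≡ t * (c * d + s)
  distrib = solve-∀

module _ (A : Mat k m) where

  ideal-resp-≈ : y ≈[ μ ] z → InMinorIdeal μ A y → InMinorIdeal μ A z
  ideal-resp-≈ y≈z (L , L≈y) = L , ≈-trans L≈y y≈z

  ideal-0 : InMinorIdeal μ A 0ℤ
  ideal-0 = [] , ≈-reflexive refl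

  ideal-+ : InMinorIdeal μ A y → InMinorIdeal μ A z → InMinorIdeal μ A (y + z)
  ideal-+ (L , L≈y) (L′ , L′≈z) =
    L ++ L′ , ≈-trans (≈-reflexive (sumMinors-++ A L L′)) (+-cong-≈ L≈y L′≈z)

  ideal-scale : ∀ t → InMinorIdeal μ A y → InMinorIdeal μ A (t * y)
  ideal-scale t (L , L≈y) =
    List.map (map₂ (t *_)) L , ≈-trans (≈-reflexive (sumMinors-scale A t L)) (*-congˡ-≈ t L≈y)

  ideal-∑ : ∀ {j} (f : Fin j → ℤ) → (∀ i → InMinorIdeal μ A (f i)) → InMinorIdeal μ A (∑ f)
  ideal-∑ {j = zero}  f f∈ = ideal-0
  ideal-∑ {j = suc j} f f∈ = ideal-+ (f∈ zero) (ideal-∑ (f ∘ suc) (f∈ ∘ suc))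

  ideal-minor : ∀ σ → InMinorIdeal μ A (minor A σ)
  ideal-minor σ =
    (σ , 1ℤ) List.∷ [] , ≈-reflexive (trans (ℤ.+-identityʳ (1ℤ * minor A σ)) (ℤ.*-identityˡ (minor A σ)))

ideal-mono : ∀ {j n} {A : Mat k m} {B : Mat j n} → (∀ σ → InMinorIdeal μ A (minor B σ)) →
             InMinorIdeal μ B y → InMinorIdeal μ A y
ideal-mono {A = A} {B} minors∈ (L , L≈y) = ideal-resp-≈ A L≈y (sumMinors∈ L)
  where
  sumMinors∈ : ∀ L → InMinorIdeal _ A (sumMinors B L)
  sumMinors∈ []                 = ideal-0 A
  sumMinors∈ ((σ , c) List.∷ L) = ideal-+ A (ideal-scale A c (minors∈ σ)) (sumMinors∈ L)

ideal-det-prepend : (A : Mat (suc k) m) (l : Fin m) {τ : Fin k → Fin m} → StrictlyIncreasing τ →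
                    InMinorIdeal μ A (det (columns A (l ∷ τ)))
ideal-det-prepend A l {τ} τ-inc with insert l τ τ-inc
... | degenerate vanishes            = ideal-resp-≈ A (≈-reflexive (sym (vanishes A))) (ideal-0 A)
... | signed-minor σ ε signed-minor≡ _ =
  ideal-resp-≈ A (≈-reflexive (sym (signed-minor≡ A))) (ideal-scale A ε (ideal-minor A σ))

-- Surjectivity modulo μ

ColumnsGenerate : (Fin k → ℕ) → Mat k m → Set
ColumnsGenerate {k} {m} ms A = ∀ (h : Fin k → ℤ) → ∃ λ (x : Fin m → ℤ) → ∀ ρ → (A · x) ρ ≈[ ms ρ ] h ρ

SurjectiveMod : ℕ → Mat k m → Set
SurjectiveMod μ = ColumnsGenerate (λ _ → μ)

columnsGenerate-tail : ∀ {ms} {A : Mat (suc k) m} → ColumnsGenerate ms A →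
                       ColumnsGenerate (tail ms) (tail A)
columnsGenerate-tail generate h = map₂ (_∘ suc) (generate (0ℤ ∷ h))

det-prepend-combination : (A : Mat (suc k) m) (τ : Fin k → Fin m) (x : Fin m → ℤ) →
  ∑ (λ l → x l * det (columns A (l ∷ τ))) ≡ ∑ (λ i → (sign i * det (columns (A ∘ punchIn i) τ)) * (A · x) i)
det-prepend-combination {k} A τ x = begin
    ∑ (λ l → x l * det (columns A (l ∷ τ)))
  ≡⟨ ∑-cong (λ l → cong (x l *_) (det-expand-first-column (columns A (l ∷ τ)))) ⟩
    ∑ (λ l → x l * ∑ (λ i → sign i * (A i l * C i)))
  ≡⟨ ∑-cong (λ l → *-distribˡ-∑ (x l) (λ i → sign i * (A i l * C i))) ⟩
    ∑ (λ l → ∑ (λ i → x l * (sign i * (A i l * C i))))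
  ≡⟨ ∑-comm (λ l i → x l * (sign i * (A i l * C i))) ⟩
    ∑ (λ i → ∑ (λ l → x l * (sign i * (A i l * C i))))
  ≡⟨ ∑-cong (λ i → ∑-cong (λ l → regroup (x l) (sign i) (A i l) (C i))) ⟩
    ∑ (λ i → ∑ (λ l → (sign i * C i) * (x l * A i l)))
  ≡⟨ ∑-cong (λ i → *-distribˡ-∑ (sign i * C i) (λ l → x l * A i l)) ⟨
    ∑ (λ i → (sign i * C i) * (A · x) i)
  ∎
  where
  open ≡-Reasoning
  C : Fin (suc k) → ℤ
  C i = det (columns (A ∘ punchIn i) τ)
  regroup : ∀ x s a c → x * (s * (a * c)) ≡ (s * c) * (x * a)
  regroup = solve-∀

tail-minor∈ideal : {A : Mat (suc k) m} → SurjectiveMod μ A → ∀ τ → InMinorIdeal μ A (minor (tail A) τ)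
tail-minor∈ideal {k} {m} {μ} {A} surjective (τ , τ-inc) =
  ideal-resp-≈ A combination≈minor
    (ideal-∑ A (λ l → x l * det (columns A (l ∷ τ)))
               (λ l → ideal-scale A (x l) (ideal-det-prepend A l τ-inc)))
  where
  x : Fin m → ℤ
  x = proj₁ (surjective (unit zero))
  Ax≈e₀ : ∀ i → (A · x) i ≈[ μ ] unit zero i
  Ax≈e₀ = proj₂ (surjective (unit zero))
  C : Fin (suc k) → ℤ
  C i = sign i * det (columns (A ∘ punchIn i) τ)
  combination≈minor : ∑ (λ l → x l * det (columns A (l ∷ τ))) ≈[ μ ] minor (tail A) (τ , τ-inc)
  combination≈minor = begin
    ∑ (λ l → x l * det (columns A (l ∷ τ)))  ≡⟨ det-prepend-combination A τ x ⟩
    ∑ (λ i → C i * (A · x) i)                ≈⟨ ∑-cong-≈ (λ i → *-congˡ-≈ (C i) (Ax≈e₀ i)) ⟩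
    ∑ (λ i → C i * unit zero i)              ≡⟨ ∑-cong (λ i → ℤ.*-comm (C i) (unit zero i)) ⟩
    ∑ (λ i → unit zero i * C i)              ≡⟨ ∑-unit zero C ⟩
    C zero                                   ≡⟨ ℤ.*-identityˡ (minor (tail A) (τ , τ-inc)) ⟩
    minor (tail A) (τ , τ-inc)               ∎
    where open ≈-Reasoning μ

surjectiveMod⇒minorIdeal : {A : Mat k m} → SurjectiveMod μ A → ∀ h → InMinorIdeal μ A h
surjectiveMod⇒minorIdeal {zero} _ h =
  (((λ ()) , (λ ())) , h) List.∷ [] , ≈-reflexive (trans (ℤ.+-identityʳ (h * 1ℤ)) (ℤ.*-identityʳ h))
surjectiveMod⇒minorIdeal {suc k} surjective h =
  ideal-mono (tail-minor∈ideal surjective) (surjectiveMod⇒minorIdeal (columnsGenerate-tail surjective) h)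

punchIn-mono-< : ∀ (j : Fin (suc k)) {a b} → a < b → punchIn j a < punchIn j b
punchIn-mono-< zero                      a<b       = s<s a<b
punchIn-mono-< (suc j) {zero}  {suc b}   _         = z<s
punchIn-mono-< (suc j) {suc a} {suc b}   (s<s a<b) = s<s (punchIn-mono-< j a<b)

minor∈tail-ideal : {A : Mat (suc k) m} → ∀ σ → InMinorIdeal μ (tail A) (minor A σ)
minor∈tail-ideal {A = A} (σ , σ-inc) =
  ideal-resp-≈ (tail A) (≈-reflexive (∑-cong (λ j → ℤ.*-assoc (sign j) (A zero (σ j)) (cofactor j))))
    (ideal-∑ (tail A) (λ j → sign j * A zero (σ j) * cofactor j)
      (λ j → ideal-scale (tail A) (sign j * A zero (σ j)) (ideal-minor (tail A) (σ∖ j))))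
  where
  σ∖ : ∀ j → ColumnChoice _ _
  σ∖ j = σ ∘ punchIn j , λ a b a<b → σ-inc _ _ (punchIn-mono-< j a<b)
  cofactor : ∀ j → ℤ
  cofactor j = minor (tail A) (σ∖ j)

zeros : Fin k → ℤ
zeros _ = 0ℤ

minor∈span : {A : Mat (suc k) m} → ∀ σ → ColumnSpan A (minor A σ ∷ zeros)
minor∈span {A = A} (σ , σ-inc) =
  span-resp-≗ A cofactor-expansion
    (span-∑ A (λ j ρ → (sign j * cofactor j) * A ρ (σ j))
      (λ j → span-scale A (sign j * cofactor j) (span-column A (σ j))))
  where
  cofactor : ∀ j → ℤ
  cofactor j = det (λ a b → A (suc a) (σ (punchIn j b)))
  regroup : ∀ s c a → s * c * a ≡ s * (a * c)
  regroup = solve-∀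
  cofactor-expansion : (λ ρ → ∑ (λ j → (sign j * cofactor j) * A ρ (σ j))) ≗
                       minor A (σ , σ-inc) ∷ zeros
  cofactor-expansion zero    = ∑-cong (λ j → regroup (sign j) (cofactor j) (A zero (σ j)))
  cofactor-expansion (suc ρ) = trans (∑-cong (λ j → regroup (sign j) (cofactor j) (A (suc ρ) (σ j))))
                                     (det-equal-rows (λ a b → (A (suc ρ) ∷ tail A) a (σ b)) ρ (λ b → refl))

sumMinors∈span : (A : Mat (suc k) m) → ∀ L → ColumnSpan A (sumMinors A L ∷ zeros)
sumMinors∈span A []                 = span-resp-≗ A (λ { zero → refl ; (suc ρ) → refl }) (span-0 A)
sumMinors∈span A ((σ , c) List.∷ L) =
  span-resp-≗ A add (span-+ A (span-scale A c (minor∈span σ)) (sumMinors∈span A L))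
  where
  add : (λ ρ → c * (minor A σ ∷ zeros) ρ + (sumMinors A L ∷ zeros) ρ) ≗
        sumMinors A ((σ , c) List.∷ L) ∷ zeros
  add zero    = refl
  add (suc ρ) = trans (ℤ.+-identityʳ (c * 0ℤ)) (ℤ.*-zeroʳ c)

surjectiveMod-cons : {A : Mat (suc k) m} {u : ℤ} → SurjectiveMod μ (tail A) → ColumnSpan A (u ∷ zeros) →
                     u ≈[ μ ] 1ℤ → SurjectiveMod μ A
surjectiveMod-cons {μ = μ} {A} {u} surjective (x , Ax≗u) u≈1 h = c , solves
  where
  c′ = proj₁ (surjective (tail h))
  t = h zero - (A · c′) zero
  c = λ l → c′ l + t * x l
  split : ∀ ρ → (A · c) ρ ≡ (A · c′) ρ + t * (u ∷ zeros) ρ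
  split ρ = trans (·-distrib-+ A c′ (λ l → t * x l) ρ)
                  (cong (_+_ ((A · c′) ρ)) (trans (·-scale A t x ρ) (cong (t *_) (Ax≗u ρ))))
  cancel : ∀ a h → a + (h - a) * 1ℤ ≡ h
  cancel = solve-∀
  solves : ∀ ρ → (A · c) ρ ≈[ μ ] h ρ
  solves zero = begin
    (A · c) zero            ≡⟨ split zero ⟩
    (A · c′) zero + t * u   ≈⟨ +-congˡ-≈ ((A · c′) zero) (*-congˡ-≈ t u≈1) ⟩
    (A · c′) zero + t * 1ℤ  ≡⟨ cancel ((A · c′) zero) (h zero) ⟩
    h zero                  ∎
    where open ≈-Reasoning μ
  solves (suc ρ) = begin
    (A · c) (suc ρ)              ≡⟨ split (suc ρ) ⟩
    (A · c′) (suc ρ) + t * 0ℤ    ≡⟨ trans (cong (_+_ ((A · c′) (suc ρ))) (ℤ.*-zeroʳ t)) (ℤ.+-identityʳ _) ⟩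
    (A · c′) (suc ρ)             ≈⟨ proj₂ (surjective (tail h)) ρ ⟩
    h (suc ρ)                    ∎
    where open ≈-Reasoning μ

minorIdeal⇒surjectiveMod : {A : Mat k m} → (∀ h → InMinorIdeal μ A h) → SurjectiveMod μ A
minorIdeal⇒surjectiveMod {zero}          _         h = zeros , λ ()
minorIdeal⇒surjectiveMod {suc k} {A = A} generated =
  surjectiveMod-cons (minorIdeal⇒surjectiveMod (ideal-mono (minor∈tail-ideal {A = A}) ∘ generated))
                     (sumMinors∈span A (proj₁ (generated 1ℤ))) (proj₂ (generated 1ℤ))

surjectiveMod⇔maximalMinorsGenerateMod : {A : Mat k m} → SurjectiveMod μ A ⇔ MaximalMinorsGenerateMod μ A
surjectiveMod⇔maximalMinorsGenerateMod = mk⇔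
  (λ surjective h → map₂ ≈⇒≡[] (surjectiveMod⇒minorIdeal surjective h))
  (λ generated → minorIdeal⇒surjectiveMod (map₂ ≡[]⇒≈ ∘ generated))

-- Degree matrices

data InitOrLast {k : ℕ} : Fin (suc k) → Set where
  init-index : (ρ : Fin k) → InitOrLast (inject₁ ρ)
  last-index : InitOrLast (fromℕ k)

initOrLast : (ρ : Fin (suc k)) → InitOrLast ρ
initOrLast {zero}  zero    = last-index
initOrLast {suc k} zero    = init-index zero
initOrLast {suc k} (suc ρ) with initOrLast ρ
... | init-index ρ′ = init-index (suc ρ′)
... | last-index    = last-index

columnsGenerate-resp : ∀ {ms ms′ : Fin k → ℕ} {A B : Mat k m} → ms ≗ ms′ → (∀ ρ → A ρ ≗ B ρ) →
                       ColumnsGenerate ms A → ColumnsGenerate ms′ B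
columnsGenerate-resp {ms′ = ms′} {B = B} ms≗ms′ A≗B generate h with generate h
... | x , Ax≈h = x , λ ρ → subst (λ μ → (B · x) ρ ≈[ μ ] h ρ) (ms≗ms′ ρ)
                    (≈-trans (≈-reflexive (∑-cong (λ l → cong (x l *_) (sym (A≗B ρ l))))) (Ax≈h ρ))

columnsGenerate⇒surjectiveMod : ∀ {μ} {ms : Fin k → ℕ} {A : Mat k m} → (∀ ρ → μ ∣ ms ρ) →
                                ColumnsGenerate ms A → SurjectiveMod μ A
columnsGenerate⇒surjectiveMod μ∣ms generate h =
  map₂ (λ Ax≈h ρ → ≈-weaken (μ∣ms ρ) (Ax≈h ρ)) (generate h)

-- d solves the system modulo μ₀ = last ms with error μ₀ q; subtracting μ₀ e, where
-- init A · e ≡ q modulo init ms, removes that error in the other rows.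
columnsGenerate-init-last : ∀ {ms : Fin (suc k) → ℕ} {A : Mat (suc k) m} →
  ColumnsGenerate (init ms) (init A) → SurjectiveMod (last ms) A → ColumnsGenerate ms A
columnsGenerate-init-last {k} {m} {ms} {A} generate-init surjective h = c , solves
  where
  open Signed._∣_ using (quotient; equality)
  μ₀ = last ms
  d = proj₁ (surjective h)
  q : Fin (suc k) → ℤ
  q ρ = quotient (_≈[_]_.μ∣a-b (proj₂ (surjective h) ρ))
  e = proj₁ (generate-init (init q))
  c : Fin m → ℤ
  c l = d l + - + μ₀ * e l
  Ac≡ : ∀ ρ → (A · c) ρ ≡ h ρ + q ρ * + μ₀ + - + μ₀ * (A · e) ρ
  Ac≡ ρ = begin
    (A · c) ρ                                   ≡⟨ ·-distrib-+ A d (λ l → - + μ₀ * e l) ρ ⟩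
    (A · d) ρ + (A · (λ l → - + μ₀ * e l)) ρ    ≡⟨ cong₂ _+_ (add-difference ((A · d) ρ) (h ρ)) (·-scale A (- + μ₀) e ρ) ⟩
    h ρ + ((A · d) ρ - h ρ) + - + μ₀ * (A · e) ρ
      ≡⟨ cong (λ δ → h ρ + δ + - + μ₀ * (A · e) ρ) (equality (_≈[_]_.μ∣a-b (proj₂ (surjective h) ρ))) ⟩
    h ρ + q ρ * + μ₀ + - + μ₀ * (A · e) ρ       ∎
    where
    open ≡-Reasoning
    add-difference : ∀ a b → a ≡ b + (a - b)
    add-difference = solve-∀
  init-row : ∀ ρ → (A · e) ρ ≈[ ms ρ ] q ρ → (A · c) ρ ≈[ ms ρ ] h ρ
  init-row ρ Ae≈q = begin
    (A · c) ρ                                ≡⟨ Ac≡ ρ ⟩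
    h ρ + q ρ * + μ₀ + - + μ₀ * (A · e) ρ    ≈⟨ +-congˡ-≈ (h ρ + q ρ * + μ₀) (*-congˡ-≈ (- + μ₀) Ae≈q) ⟩
    h ρ + q ρ * + μ₀ + - + μ₀ * q ρ          ≡⟨ cancel (h ρ) (q ρ) (+ μ₀) ⟩
    h ρ                                      ∎
    where
    open ≈-Reasoning (ms ρ)
    cancel : ∀ h q m → h + q * m + - m * q ≡ h
    cancel = solve-∀
  last-row : ∀ ρ → (A · c) ρ ≈[ μ₀ ] h ρ
  last-row ρ = begin
    (A · c) ρ                                ≡⟨ Ac≡ ρ ⟩
    h ρ + q ρ * + μ₀ + - + μ₀ * (A · e) ρ    ≡⟨ collect (h ρ) (q ρ) (+ μ₀) ((A · e) ρ) ⟩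
    h ρ + (q ρ - (A · e) ρ) * + μ₀           ≈⟨ +-congˡ-≈ (h ρ) (*μ≈0 (q ρ - (A · e) ρ)) ⟩
    h ρ + 0ℤ                                 ≡⟨ ℤ.+-identityʳ (h ρ) ⟩
    h ρ                                      ∎
    where
    open ≈-Reasoning μ₀
    collect : ∀ h q m y → h + q * m + - m * y ≡ h + (q - y) * m
    collect = solve-∀
  solves : ∀ ρ → (A · c) ρ ≈[ ms ρ ] h ρ
  solves ρ with initOrLast ρ
  ... | init-index ρ′ = init-row (inject₁ ρ′) (proj₂ (generate-init (init q)) ρ′)
  ... | last-index    = last-row (fromℕ k)

snocℕ-inject₁ : (f : Fin m → ℕ) (x : ℕ) (j : Fin m) → snocℕ f x (inject₁ j) ≡ f j
snocℕ-inject₁ {suc m} f x zero    = refl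
snocℕ-inject₁ {suc m} f x (suc j) = snocℕ-inject₁ (f ∘ suc) x j

snocℕ-fromℕ : (f : Fin m → ℕ) (x : ℕ) → snocℕ f x (fromℕ m) ≡ x
snocℕ-fromℕ {zero}  f x = refl
snocℕ-fromℕ {suc m} f x = snocℕ-fromℕ (f ∘ suc) x

snocℕ-all : (P : ℕ → Set) {f : Fin m → ℕ} {x : ℕ} → (∀ j → P (f j)) → P x → ∀ j → P (snocℕ f x j)
snocℕ-all {zero}  P Pf Px zero    = Px
snocℕ-all {suc m} P Pf Px zero    = Pf zero
snocℕ-all {suc m} P Pf Px (suc j) = snocℕ-all P (Pf ∘ suc) Px j

appendRow-inject₁ : (A : Mat k m) (v : Fin m → ℤ) (ρ : Fin k) → appendRow A v (inject₁ ρ) ≡ A ρ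
appendRow-inject₁ {suc k} A v zero    = refl
appendRow-inject₁ {suc k} A v (suc ρ) = appendRow-inject₁ (A ∘ suc) v ρ

modulus-snocℕ-inject₁ : (ν : Fin s → ℕ) (μ : ℕ) (ρ : Fin (suc s)) →
                        modulus (snocℕ ν μ) (inject₁ ρ) ≡ modulus ν ρ
modulus-snocℕ-inject₁ ν μ zero    = refl
modulus-snocℕ-inject₁ ν μ (suc j) = snocℕ-inject₁ ν μ j

generateWithout⇔columnsGenerate : ∀ {ν : Fin s → ℕ} {Q : Mat (suc s) (suc n)} {i} →
  GenerateWithout ν Q i ⇔ ColumnsGenerate (modulus ν) (removeCol Q i)
generateWithout⇔columnsGenerate = mk⇔ (λ generate h → map₂ (≡[]⇒≈ ∘_) (generate h))
                                      (λ generate h → map₂ (≈⇒≡[] ∘_) (generate h))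

generateWithout-appendRow : ∀ {μ} {ν : Fin s → ℕ} {Q : Mat (suc s) (suc n)} {v i} →
  GenerateWithout ν Q i → MaximalMinorsGenerateMod μ (removeCol (appendRow Q v) i) →
  GenerateWithout (snocℕ ν μ) (appendRow Q v) i
generateWithout-appendRow {μ = μ} {ν} {Q} {v} {i} generate minorsGenerate =
  Equivalence.from (generateWithout⇔columnsGenerate {Q = appendRow Q v} {i}) (columnsGenerate-init-last
    (columnsGenerate-resp (sym ∘ modulus-snocℕ-inject₁ ν μ)
                          (λ ρ l → cong (λ row → row (punchIn i l)) (sym (appendRow-inject₁ Q v ρ)))
                          (Equivalence.to (generateWithout⇔columnsGenerate {Q = Q} {i}) generate))
    (columnsGenerate-resp (λ _ → sym (snocℕ-fromℕ ν μ)) (λ _ _ → refl)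
                          (Equivalence.from surjectiveMod⇔maximalMinorsGenerateMod minorsGenerate)))

DivisorChain : (Fin s → ℕ) → Set
DivisorChain ν = ∀ j k → toℕ k ≡ suc (toℕ j) → ν k ∣ ν j

last∣ : (ν : Fin (suc s) → ℕ) → DivisorChain ν → ∀ j → ν (fromℕ s) ∣ ν j
last∣ {zero}  ν chain zero    = ∣-refl
last∣ {suc s} ν chain zero    = ∣-trans (last∣ (ν ∘ suc) (λ j k → chain (suc j) (suc k) ∘ cong suc) zero)
                                        (chain zero (suc zero) refl)
last∣ {suc s} ν chain (suc j) = last∣ (ν ∘ suc) (λ j k → chain (suc j) (suc k) ∘ cong suc) j

snocℕ-divisorChain : {ν : Fin (suc r) → ℕ} {μ : ℕ} → DivisorChain ν → μ ∣ ν (fromℕ r) →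
                     DivisorChain (snocℕ ν μ)
snocℕ-divisorChain {zero}  chain μ∣νᵣ zero    (suc zero)    _  = μ∣νᵣ
snocℕ-divisorChain {suc r} chain μ∣νᵣ zero    (suc zero)    _  = chain zero (suc zero) refl
snocℕ-divisorChain {suc r} chain μ∣νᵣ (suc j) (suc k)       eq =
  snocℕ-divisorChain (λ j k → chain (suc j) (suc k) ∘ cong suc) μ∣νᵣ j k (ℕ.suc-injective eq)

snocℕ-invariantFactorForm : {ν : Fin (suc r) → ℕ} {μ : ℕ} → InvariantFactorForm ν → 2 ≤ μ →
                            μ ∣ ν (fromℕ r) → InvariantFactorForm (snocℕ ν μ)
snocℕ-invariantFactorForm (ν≥2 , chain) μ≥2 μ∣νᵣ = snocℕ-all (2 ≤_) ν≥2 μ≥2 , snocℕ-divisorChain chain μ∣νᵣ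

snocℕ-invariantFactorForm⇒∣ : {ν : Fin (suc r) → ℕ} {μ : ℕ} → InvariantFactorForm (snocℕ ν μ) →
                              μ ∣ ν (fromℕ r)
snocℕ-invariantFactorForm⇒∣ {r} {ν} {μ} (_ , chain) =
  subst₂ _∣_ (snocℕ-fromℕ ν μ) (snocℕ-inject₁ ν μ (fromℕ r))
             (last∣ (snocℕ ν μ) chain (inject₁ (fromℕ r)))

snocℕ-invariantFactorForm⇒∣modulus : {ν : Fin (suc r) → ℕ} {μ : ℕ} → InvariantFactorForm (snocℕ ν μ) →
                                     ∀ ρ → μ ∣ modulus (snocℕ ν μ) ρ
snocℕ-invariantFactorForm⇒∣modulus {μ = μ} _            zero    = μ ∣0
snocℕ-invariantFactorForm⇒∣modulus {ν = ν} {μ} (_ , chain) (suc j) =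
  subst (_∣ snocℕ ν μ j) (snocℕ-fromℕ ν μ) (last∣ (snocℕ ν μ) chain j)

generateWithout⇒minorsGenerate : ∀ {μ} {ν : Fin s → ℕ} {Q : Mat (suc s) (suc n)} {i} →
  (∀ ρ → μ ∣ modulus ν ρ) → GenerateWithout ν Q i → MaximalMinorsGenerateMod μ (removeCol Q i)
generateWithout⇒minorsGenerate {Q = Q} {i} μ∣ν =
  Equivalence.to surjectiveMod⇔maximalMinorsGenerateMod ∘ columnsGenerate⇒surjectiveMod μ∣ν
  ∘ Equivalence.to (generateWithout⇔columnsGenerate {Q = Q} {i})

proposition4p11 : (r n : ℕ) (μs : Fin (suc r) → ℕ) → InvariantFactorForm μs →
    (Q : Mat (suc (suc r)) (suc n)) → IsDegreeMatrix μs Q →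
    (μ : ℕ) → 2 ≤ μ →
    (ζ : Fin (suc n) → ℤ) → IsTorsionVector μ (Q zero) ζ →
    ((IsDegreeMatrix (snocℕ μs μ) (appendRow Q ζ) × InvariantFactorForm (snocℕ μs μ))
      ⇔
     (μ ∣ μs (fromℕ r) ×
      (∀ (i : Fin (suc n)) → MaximalMinorsGenerateMod μ (removeCol (appendRow Q ζ) i))))
proposition4p11 r n μs μs-form Q (w≥1 , generate) μ μ≥2 ζ _ = mk⇔
  (λ ((_ , generateζ) , form) →
     snocℕ-invariantFactorForm⇒∣ form ,
     λ i → generateWithout⇒minorsGenerate {Q = appendRow Q ζ} {i}
             (snocℕ-invariantFactorForm⇒∣modulus form) (generateζ i))
  (λ (μ∣μᵣ , minorsGenerate) →
     (w≥1 , λ i → generateWithout-appendRow (generate i) (minorsGenerate i)) ,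
     snocℕ-invariantFactorForm μs-form μ≥2 μ∣μᵣ)
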